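{- For every $n \ge 1$ and every function $f \colon \{0,1\}^n \to \{ -1,1\}$ we have $\deg_2(f) \le \mathsf{gran}(f) + 1$.
   Context: For $S \subseteq [n]=\{1,\dots,n\}$ let $\chi_S(x)=\prod_{i\in S}(-1)^{x_i}$ and $\widehat{f}(S)=2^{ -n}\sum_{x\in\{0,1\}^n} f(x)\chi_S(x)$ (Fourier coefficient). For a rational number $\alpha$ whose denominator is a power of $2$, $\mathsf{gran}(\alpha)$ is the minimal integer $k\ge 0$ such that $2^k\alpha$ is an integer. The granularity of $f$ is $\mathsf{gran}(f)=\max_{S\subseteq[n]}\mathsf{gran}(\widehat{f}(S))$. The value $-1$ is interpreted as "true" and $1$ as "false"; $\deg_2(f)$ is the degree of the unique multilinear polynomial $p\in\mathbb{F}_2[x_1,\dots,x_n]$ with $p(x)=1$ iff $f(x)=-1$, for all $x\in\mathbb{F}_2^n$. -}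

module Defs where

open import Data.Bool using (Bool; true; false; _∧_; _∨_; not; _xor_; if_then_else_)
open import Data.Nat as ℕ using (ℕ; zero; suc; _^_; _≤_; _<_)
open import Data.Nat.Properties using (m^n≢0)
open import Data.Integer as ℤ using (ℤ; +_; -_)
open import Data.Rational as ℚ using (ℚ; _/_)
open import Data.Vec using (Vec; []; _∷_; zipWith; foldr)
open import Data.List as List using (List; []; _∷_; _++_)
open import Data.Fin.Subset using (Subset; ∣_∣)
open import Data.Product using (Σ; ∃; _×_)
open import Relation.Binary.PropositionalEquality using (_≡_)
open import Relation.Nullary using (¬_)

-- Points of {0,1}^n: Bool vectors, true = 1, false = 0.
Point : ℕ → Set
Point n = Vec Bool n

allVecs : (n : ℕ) → List (Vec Bool n)
allVecs zero = [] ∷ []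
allVecs (suc n) = List.map (false ∷_) (allVecs n) ++ List.map (true ∷_) (allVecs n)

χ : {n : ℕ} → Subset n → Point n → ℤ
χ S x = foldr _ ℤ._*_ (+ 1) (zipWith (λ s xi → if s ∧ xi then - (+ 1) else + 1) S x)

sumℤ : List ℤ → ℤ
sumℤ = List.foldr ℤ._+_ (+ 0)

fourier : {n : ℕ} → (Point n → ℤ) → Subset n → ℚ
fourier {n} f S =
  _/_ (sumℤ (List.map (λ x → f x ℤ.* χ S x) (allVecs n))) (2 ^ n) {{m^n≢0 2 n}}

IsIntegerℚ : ℚ → Set
IsIntegerℚ q = ∃ λ (z : ℤ) → q ≡ z / 1

IsGran : ℚ → ℕ → Set
IsGran α k = IsIntegerℚ ((+ (2 ^ k) / 1) ℚ.* α)
           × (∀ j → j < k → ¬ IsIntegerℚ ((+ (2 ^ j) / 1) ℚ.* α))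

IsGranF : {n : ℕ} → (Point n → ℤ) → ℕ → Set
IsGranF {n} f g = (∃ λ (S : Subset n) → IsGran (fourier f S) g)
                × (∀ (S : Subset n) k → IsGran (fourier f S) k → k ≤ g)

-- Multilinear polynomials over F₂ in x₁..xₙ: a coefficient (in F₂ = Bool)
-- for each monomial ∏_{i∈T} x_i, T ⊆ [n].
F2Poly : ℕ → Set
F2Poly n = Subset n → Bool

monomial : {n : ℕ} → Subset n → Point n → Bool
monomial T x = foldr _ _∧_ true (zipWith (λ t xi → not t ∨ xi) T x)

evalF2 : {n : ℕ} → F2Poly n → Point n → Bool
evalF2 {n} p x = List.foldr _xor_ false (List.map (λ T → p T ∧ monomial T x) (allVecs n))

Represents : {n : ℕ} → (Point n → ℤ) → F2Poly n → Set
Represents f p = ∀ x → (evalF2 p x ≡ true → f x ≡ - (+ 1)) × (f x ≡ - (+ 1) → evalF2 p x ≡ true)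

DegreeAtMost : {n : ℕ} → F2Poly n → ℕ → Set
DegreeAtMost p d = ∀ T → p T ≡ true → ∣ T ∣ ≤ d

IsBoolFun : {n : ℕ} → (Point n → ℤ) → Set
IsBoolFun f = ∀ x → (f x ≡ + 1) Data.Sum.⊎ (f x ≡ - (+ 1))
  where import Data.Sum

-- Write f = 1 − 2p, where p is the F₂-polynomial of f, and fix a monomial x_T of p with
-- |T| = d ≥ g + 2.  The subcube sum B = Σ_{x ⊆ T} f(x) equals 2^d − 2C, where C counts the
-- points x ⊆ T with p(x) = 1; by Möbius inversion over F₂ the parity of C is the coefficient
-- of x_T, so C is odd and B ≡ 2 (mod 4).  On the other hand Σ_{S ⊆ ∁T} χ_S(x) = 2^{n−d}[x ⊆ T],
-- hence 2^{n−d} B = Σ_{S ⊆ ∁T} 2^n f̂(S).  Granularity g means 2^n ∣ 2^g · 2^n f̂(S) for every S,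
-- so 2^n ∣ 2^{g+n−d} B, i.e. 2^{d−g} ∣ B, and 4 ∣ B: a contradiction.
module Submission where

open import Algebra.Bundles using (Semiring; CommutativeRing; CommutativeMonoid)
open import Data.Bool using (Bool; true; false; not; _∧_; _∨_; _xor_; if_then_else_)
open import Data.List using (List; []; _∷_; _++_; foldr; map)
open import Data.Nat as ℕ using (ℕ; zero; suc; _^_)
open import Data.Vec using ([]; _∷_)
open import Function using (_∘_)

open import Defs

module ListSum {c ℓ} (R : Semiring c ℓ) where

  open Semiring R
  open import Algebra.Properties.CommutativeSemigroup +-commutativeSemigroup using (interchange)

  ∑ : {X : Set} → List X → (X → Carrier) → Carrier
  ∑ xs F = foldr _+_ 0# (map F xs)

  syntax ∑ xs (λ x → e) = ∑[ x ∈ xs ] e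

  ∑-cong : {X : Set} (xs : List X) {F G : X → Carrier} → (∀ x → F x ≈ G x) → ∑ xs F ≈ ∑ xs G
  ∑-cong []       F≈G = refl
  ∑-cong (x ∷ xs) F≈G = +-cong (F≈G x) (∑-cong xs F≈G)

  ∑-++ : {X : Set} (xs ys : List X) (F : X → Carrier) → ∑ (xs ++ ys) F ≈ ∑ xs F + ∑ ys F
  ∑-++ []       ys F = sym (+-identityˡ _)
  ∑-++ (x ∷ xs) ys F = trans (+-congˡ (∑-++ xs ys F)) (sym (+-assoc _ _ _))

  ∑-map : {X Y : Set} (g : X → Y) (xs : List X) (F : Y → Carrier) → ∑ (map g xs) F ≈ ∑ xs (F ∘ g)
  ∑-map g []       F = refl
  ∑-map g (x ∷ xs) F = +-congˡ (∑-map g xs F)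

  ∑-zero : {X : Set} (xs : List X) → ∑[ x ∈ xs ] 0# ≈ 0#
  ∑-zero []       = refl
  ∑-zero (x ∷ xs) = trans (+-identityˡ _) (∑-zero xs)

  ∑-distrib-+ : {X : Set} (xs : List X) (F G : X → Carrier) →
                ∑[ x ∈ xs ] (F x + G x) ≈ ∑ xs F + ∑ xs G
  ∑-distrib-+ []       F G = sym (+-identityˡ 0#)
  ∑-distrib-+ (x ∷ xs) F G = trans (+-congˡ (∑-distrib-+ xs F G)) (interchange _ _ _ _)

  *-distribˡ-∑ : {X : Set} (a : Carrier) (xs : List X) (F : X → Carrier) →
                 ∑[ x ∈ xs ] (a * F x) ≈ a * ∑ xs F
  *-distribˡ-∑ a []       F = sym (zeroʳ a)
  *-distribˡ-∑ a (x ∷ xs) F = trans (+-congˡ (*-distribˡ-∑ a xs F)) (sym (distribˡ _ _ _))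

  ∑-comm : {X Y : Set} (xs : List X) (ys : List Y) (F : X → Y → Carrier) →
           ∑[ x ∈ xs ] ∑[ y ∈ ys ] F x y ≈ ∑[ y ∈ ys ] ∑[ x ∈ xs ] F x y
  ∑-comm []       ys F = sym (∑-zero ys)
  ∑-comm (x ∷ xs) ys F = trans (+-congˡ (∑-comm xs ys F))
                               (sym (∑-distrib-+ ys (F x) (λ y → ∑[ x ∈ xs ] F x y)))

  ∑-allVecs-suc : (n : ℕ) (F : Point (suc n) → Carrier) →
                  ∑ (allVecs (suc n)) F ≈ ∑ (allVecs n) (F ∘ (false ∷_)) + ∑ (allVecs n) (F ∘ (true ∷_))
  ∑-allVecs-suc n F = trans (∑-++ (map (false ∷_) (allVecs n)) _ F)
                            (+-cong (∑-map (false ∷_) (allVecs n) F) (∑-map (true ∷_) (allVecs n) F))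

  ∑-allVecs-suc-factor : (n : ℕ) (F : Point (suc n) → Carrier) (c : Bool → Carrier) (G : Point n → Carrier) →
                         (∀ s x → F (s ∷ x) ≈ c s * G x) →
                         ∑ (allVecs (suc n)) F ≈ (c false + c true) * ∑ (allVecs n) G
  ∑-allVecs-suc-factor n F c G F≈cG = trans (∑-allVecs-suc n F) (trans
    (+-cong (trans (∑-cong (allVecs n) (F≈cG false)) (*-distribˡ-∑ (c false) (allVecs n) G))
            (trans (∑-cong (allVecs n) (F≈cG true)) (*-distribˡ-∑ (c true) (allVecs n) G)))
    (sym (distribʳ _ _ _)))

open import Data.Bool.Properties
  using (xor-∧-commutativeRing; ∧-commutativeMonoid; xor-assoc; xor-same; xor-identityʳ; ∧-distribˡ-xor)
open import Data.Fin.Subset using (Subset; ∁; ∣_∣)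
open import Data.Fin.Subset.Properties using (∣∁p∣≡n∸∣p∣; ∣p∣≤n)
open import Data.Integer using (ℤ; +_; -_; _+_; _*_)
open import Data.Integer.Divisibility.Signed
  using (_∣_; divides; _∣?_; ∣-refl; ∣-trans; ∣ᵤ⇒∣; ∣⇒∣ᵤ;
         ∣m∣n⇒∣m+n; ∣m+n∣m⇒∣n; ∣m+n∣n⇒∣m;
         ∣m⇒∣m*n; ∣n⇒∣m*n; *-monoˡ-∣; *-cancelˡ-∣)
import Data.Integer.Properties as ℤ
open import Data.Integer.Tactic.RingSolver using (solve-∀)
import Data.Nat.Divisibility as ℕ
import Data.Nat.Properties as ℕ
open import Data.Product using (∃-syntax; _×_; _,_; proj₁; proj₂)
open import Data.Rational as ℚ using (_/_; toℚᵘ)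
open import Data.Rational.Properties using (toℚᵘ-fromℚᵘ; toℚᵘ-cong; toℚᵘ-injective; toℚᵘ-homo-*)
open import Data.Rational.Unnormalised using (mkℚᵘ; *≡*) renaming (_≃_ to _≃ᵘ_; _/_ to _/ᵘ_)
open import Data.Rational.Unnormalised.Properties using (≃-trans; ≃-sym; *-cong)
open import Data.Sum using (inj₁; inj₂)
open import Function.Bundles using (_⇔_; mk⇔; Equivalence)
open import Relation.Binary.PropositionalEquality
open import Relation.Nullary using (¬_; yes; no)
open import Relation.Unary using (Decidable)

open import Algebra.Properties.CommutativeSemigroup (CommutativeMonoid.commutativeSemigroup ∧-commutativeMonoid)
  renaming (x∙yz≈y∙xz to ∧-x∙yz≈y∙xz) using ()
open import Algebra.Properties.CommutativeSemigroup ℤ.*-commutativeSemigroup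
  renaming (interchange to *-interchange; x∙yz≈y∙xz to *-x∙yz≈y∙xz) using ()

module ∑₂ = ListSum (CommutativeRing.semiring xor-∧-commutativeRing)
module ∑ℤ = ListSum ℤ.+-*-semiring

open ∑ℤ using (∑; ∑-cong; ∑-distrib-+; *-distribˡ-∑; ∑-comm; ∑-allVecs-suc-factor)

xor-cancelˡ : ∀ a b → a xor (a xor b) ≡ b
xor-cancelˡ a b = trans (sym (xor-assoc a a b)) (cong (_xor b) (xor-same a))

evalF2-∷ : ∀ {n} (p : F2Poly (suc n)) b x →
           evalF2 p (b ∷ x) ≡ evalF2 (p ∘ (false ∷_)) x xor (b ∧ evalF2 (p ∘ (true ∷_)) x)
evalF2-∷ {n} p b x = trans (∑₂.∑-allVecs-suc n _) (cong (evalF2 (p ∘ (false ∷_)) x xor_) (trans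
  (∑₂.∑-cong (allVecs n) λ T → ∧-x∙yz≈y∙xz (p (true ∷ T)) b (monomial T x))
  (∑₂.*-distribˡ-∑ b (allVecs n) λ T → p (true ∷ T) ∧ monomial T x)))

evalF2-false∷ : ∀ {n} (p : F2Poly (suc n)) x → evalF2 p (false ∷ x) ≡ evalF2 (p ∘ (false ∷_)) x
evalF2-false∷ p x = trans (evalF2-∷ p false x) (xor-identityʳ _)

evalF2-möbius : ∀ n (p : F2Poly n) T → ∑₂.∑[ x ∈ allVecs n ] (monomial x T ∧ evalF2 p x) ≡ p T
evalF2-möbius zero    p []          with p []
... | false = refl
... | true  = refl
evalF2-möbius (suc n) p (false ∷ T) = begin
  ∑₂.∑[ x ∈ allVecs (suc n) ] (monomial x (false ∷ T) ∧ evalF2 p x)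
    ≡⟨ ∑₂.∑-allVecs-suc n _ ⟩
  ∑₂.∑[ x ∈ allVecs n ] (monomial x T ∧ evalF2 p (false ∷ x)) xor ∑₂.∑[ x ∈ allVecs n ] false
    ≡⟨ cong₂ _xor_ (∑₂.∑-cong (allVecs n) λ x → cong (monomial x T ∧_) (evalF2-false∷ p x))
                   (∑₂.∑-zero (allVecs n)) ⟩
  ∑₂.∑[ x ∈ allVecs n ] (monomial x T ∧ evalF2 (p ∘ (false ∷_)) x) xor false
    ≡⟨ xor-identityʳ _ ⟩
  ∑₂.∑[ x ∈ allVecs n ] (monomial x T ∧ evalF2 (p ∘ (false ∷_)) x)
    ≡⟨ evalF2-möbius n (p ∘ (false ∷_)) T ⟩
  p (false ∷ T) ∎
  where open ≡-Reasoning
evalF2-möbius (suc n) p (true ∷ T) = begin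
  ∑₂.∑[ x ∈ allVecs (suc n) ] (monomial x (true ∷ T) ∧ evalF2 p x)
    ≡⟨ ∑₂.∑-allVecs-suc n _ ⟩
  ∑₂.∑[ x ∈ allVecs n ] (monomial x T ∧ evalF2 p (false ∷ x)) xor
  ∑₂.∑[ x ∈ allVecs n ] (monomial x T ∧ evalF2 p (true ∷ x))
    ≡⟨ cong₂ _xor_ (∑₂.∑-cong (allVecs n) λ x → cong (monomial x T ∧_) (evalF2-false∷ p x))
                   (∑₂.∑-cong (allVecs n) λ x → trans (cong (monomial x T ∧_) (evalF2-∷ p true x))
                                                      (∧-distribˡ-xor (monomial x T) _ _)) ⟩
  S₀ xor ∑₂.∑[ x ∈ allVecs n ] ((monomial x T ∧ evalF2 p₀ x) xor (monomial x T ∧ evalF2 p₁ x))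
    ≡⟨ cong (S₀ xor_) (∑₂.∑-distrib-+ (allVecs n) _ _) ⟩
  S₀ xor (S₀ xor S₁)
    ≡⟨ xor-cancelˡ S₀ S₁ ⟩
  S₁
    ≡⟨ evalF2-möbius n p₁ T ⟩
  p (true ∷ T) ∎
  where
  open ≡-Reasoning
  p₀ p₁ : F2Poly n
  p₀ = p ∘ (false ∷_)
  p₁ = p ∘ (true ∷_)
  S₀ S₁ : Bool
  S₀ = ∑₂.∑[ x ∈ allVecs n ] (monomial x T ∧ evalF2 p₀ x)
  S₁ = ∑₂.∑[ x ∈ allVecs n ] (monomial x T ∧ evalF2 p₁ x)

⟦_⟧ : Bool → ℤ
⟦ false ⟧ = + 0
⟦ true  ⟧ = + 1

⟦∧⟧ : ∀ a b → ⟦ a ∧ b ⟧ ≡ ⟦ a ⟧ * ⟦ b ⟧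
⟦∧⟧ false b = refl
⟦∧⟧ true  b = sym (ℤ.*-identityˡ ⟦ b ⟧)

⟦⟧-+-xor : ∀ a b → ⟦ a ⟧ + ⟦ b ⟧ ≡ ⟦ a xor b ⟧ + ⟦ a ⟧ * ⟦ b ⟧ * + 2
⟦⟧-+-xor false false = refl
⟦⟧-+-xor false true  = refl
⟦⟧-+-xor true  false = refl
⟦⟧-+-xor true  true  = refl

∑-⟦⟧-parity : {X : Set} (xs : List X) (b : X → Bool) →
              ∃[ q ] ∑[ x ∈ xs ] ⟦ b x ⟧ ≡ ⟦ ∑₂.∑ xs b ⟧ + q * + 2
∑-⟦⟧-parity []       b = + 0 , refl
∑-⟦⟧-parity (x ∷ xs) b with ∑-⟦⟧-parity xs b
... | q , eq = ⟦ b x ⟧ * ⟦ B ⟧ + q , (begin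
  ⟦ b x ⟧ + ∑[ x ∈ xs ] ⟦ b x ⟧                    ≡⟨ cong (_+_ ⟦ b x ⟧) eq ⟩
  ⟦ b x ⟧ + (⟦ B ⟧ + q * + 2)                      ≡⟨ sym (ℤ.+-assoc ⟦ b x ⟧ ⟦ B ⟧ _) ⟩
  ⟦ b x ⟧ + ⟦ B ⟧ + q * + 2                        ≡⟨ cong (_+ q * + 2) (⟦⟧-+-xor (b x) B) ⟩
  ⟦ b x xor B ⟧ + ⟦ b x ⟧ * ⟦ B ⟧ * + 2 + q * + 2  ≡⟨ regroup ⟦ b x xor B ⟧ (⟦ b x ⟧ * ⟦ B ⟧) q ⟩
  ⟦ b x xor B ⟧ + (⟦ b x ⟧ * ⟦ B ⟧ + q) * + 2      ∎)
  where
  open ≡-Reasoning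
  B = ∑₂.∑ xs b
  regroup : ∀ a c q → a + c * + 2 + q * + 2 ≡ a + (c + q) * + 2
  regroup = solve-∀

subcube-size : ∀ n (T : Subset n) → ∑[ x ∈ allVecs n ] ⟦ monomial x T ⟧ ≡ + (2 ^ ∣ T ∣)
subcube-size zero    []      = refl
subcube-size (suc n) (t ∷ T) = trans
  (∑-allVecs-suc-factor n _ (λ s → ⟦ not s ∨ t ⟧) (λ x → ⟦ monomial x T ⟧) (λ s x → ⟦∧⟧ (not s ∨ t) _))
  (trans (cong ((+ 1 + ⟦ t ⟧) *_) (subcube-size n T)) (coordinate t))
  where
  coordinate : ∀ t → (+ 1 + ⟦ t ⟧) * + (2 ^ ∣ T ∣) ≡ + (2 ^ ∣ t ∷ T ∣)
  coordinate false = ℤ.*-identityˡ _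
  coordinate true  = sym (ℤ.pos-* 2 (2 ^ ∣ T ∣))

∑-χ-⊆∁ : ∀ n (T x : Point n) →
         ∑[ S ∈ allVecs n ] (⟦ monomial S (∁ T) ⟧ * χ S x) ≡ + (2 ^ ∣ ∁ T ∣) * ⟦ monomial x T ⟧
∑-χ-⊆∁ zero    []      []      = refl
∑-χ-⊆∁ (suc n) (t ∷ T) (b ∷ x) = trans
  (∑-allVecs-suc-factor n _ (c t b) (λ S → ⟦ monomial S (∁ T) ⟧ * χ S x)
    (λ s S → trans (cong (_* _) (⟦∧⟧ (not s ∨ not t) _))
                   (*-interchange ⟦ not s ∨ not t ⟧ ⟦ monomial S (∁ T) ⟧ _ (χ S x))))
  (trans (cong ((c t b false + c t b true) *_) (∑-χ-⊆∁ n T x)) (coordinate t b))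
  where
  c : Bool → Bool → Bool → ℤ
  c t b s = ⟦ not s ∨ not t ⟧ * (if s ∧ b then - + 1 else + 1)
  coordinate : ∀ t b → (c t b false + c t b true) * (+ (2 ^ ∣ ∁ T ∣) * ⟦ monomial x T ⟧) ≡
                       + (2 ^ ∣ ∁ (t ∷ T) ∣) * ⟦ monomial (b ∷ x) (t ∷ T) ⟧
  coordinate true  false = ℤ.*-identityˡ _
  coordinate true  true  = ℤ.*-identityˡ _
  coordinate false false = trans (sym (ℤ.*-assoc (+ 2) (+ (2 ^ ∣ ∁ T ∣)) _))
                                 (cong (_* ⟦ monomial x T ⟧) (sym (ℤ.pos-* 2 (2 ^ ∣ ∁ T ∣))))
  coordinate false true  = sym (ℤ.*-zeroʳ (+ (2 ^ suc ∣ ∁ T ∣)))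

fourierSum : ∀ {n} → (Point n → ℤ) → Subset n → ℤ
fourierSum {n} f S = ∑[ x ∈ allVecs n ] (f x * χ S x)

subcubeSum : ∀ {n} → (Point n → ℤ) → Subset n → ℤ
subcubeSum {n} f T = ∑[ x ∈ allVecs n ] (f x * ⟦ monomial x T ⟧)

∑-fourierSum-⊆∁ : ∀ {n} (f : Point n → ℤ) T →
  ∑[ S ∈ allVecs n ] (⟦ monomial S (∁ T) ⟧ * fourierSum f S) ≡ + (2 ^ ∣ ∁ T ∣) * subcubeSum f T
∑-fourierSum-⊆∁ {n} f T = begin
  ∑[ S ∈ allVecs n ] (⟦ monomial S (∁ T) ⟧ * fourierSum f S)
    ≡⟨ ∑-cong (allVecs n) (λ S → sym (*-distribˡ-∑ ⟦ monomial S (∁ T) ⟧ (allVecs n) λ x → f x * χ S x)) ⟩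
  ∑[ S ∈ allVecs n ] ∑[ x ∈ allVecs n ] (⟦ monomial S (∁ T) ⟧ * (f x * χ S x))
    ≡⟨ ∑-comm (allVecs n) (allVecs n) _ ⟩
  ∑[ x ∈ allVecs n ] ∑[ S ∈ allVecs n ] (⟦ monomial S (∁ T) ⟧ * (f x * χ S x))
    ≡⟨ ∑-cong (allVecs n) (λ x → trans
         (∑-cong (allVecs n) (λ S → *-x∙yz≈y∙xz ⟦ monomial S (∁ T) ⟧ (f x) (χ S x)))
         (*-distribˡ-∑ (f x) (allVecs n) λ S → ⟦ monomial S (∁ T) ⟧ * χ S x)) ⟩
  ∑[ x ∈ allVecs n ] (f x * ∑[ S ∈ allVecs n ] (⟦ monomial S (∁ T) ⟧ * χ S x))
    ≡⟨ ∑-cong (allVecs n) (λ x → trans (cong (f x *_) (∑-χ-⊆∁ n T x))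
                                       (*-x∙yz≈y∙xz (f x) (+ (2 ^ ∣ ∁ T ∣)) ⟦ monomial x T ⟧)) ⟩
  ∑[ x ∈ allVecs n ] (+ (2 ^ ∣ ∁ T ∣) * (f x * ⟦ monomial x T ⟧))
    ≡⟨ *-distribˡ-∑ (+ (2 ^ ∣ ∁ T ∣)) (allVecs n) (λ x → f x * ⟦ monomial x T ⟧) ⟩
  + (2 ^ ∣ ∁ T ∣) * subcubeSum f T ∎
  where open ≡-Reasoning

∣-∑ : ∀ {k} {X : Set} (xs : List X) (F : X → ℤ) → (∀ x → k ∣ F x) → k ∣ ∑ xs F
∣-∑ []       F k∣F = divides (+ 0) refl
∣-∑ (x ∷ xs) F k∣F = ∣m∣n⇒∣m+n (k∣F x) (∣-∑ xs F k∣F)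

^-monoʳ-∣ : ∀ b {m n} → m ℕ.≤ n → + (b ^ m) ∣ + (b ^ n)
^-monoʳ-∣ b {m} m≤n with ℕ.m≤n⇒∃[o]m+o≡n m≤n
... | o , refl = ∣ᵤ⇒∣ (subst (b ^ m ℕ.∣_) (sym (ℕ.^-distribˡ-+-* b m o)) (ℕ.m∣m*n (b ^ o)))

pos-2^-distrib-+ : ∀ m n → + (2 ^ (m ℕ.+ n)) ≡ + (2 ^ m) * + (2 ^ n)
pos-2^-distrib-+ m n = trans (cong +_ (ℕ.^-distribˡ-+-* 2 m n)) (ℤ.pos-* (2 ^ m) (2 ^ n))

∣∁p∣+∣p∣≡n : ∀ {n} (T : Subset n) → ∣ ∁ T ∣ ℕ.+ ∣ T ∣ ≡ n
∣∁p∣+∣p∣≡n T = trans (cong (ℕ._+ ∣ T ∣) (∣∁p∣≡n∸∣p∣ T)) (ℕ.m∸n+n≡m (∣p∣≤n T))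

toℚᵘ-/ : ∀ i d .{{_ : ℕ.NonZero d}} → toℚᵘ (i / d) ≃ᵘ i /ᵘ d
toℚᵘ-/ i (suc d) = toℚᵘ-fromℚᵘ (mkℚᵘ i d)

toℚᵘ-scaled : ∀ m i d .{{_ : ℕ.NonZero d}} → toℚᵘ ((m / 1) ℚ.* (i / d)) ≃ᵘ (m * i) /ᵘ d
toℚᵘ-scaled m i d@(suc _) = ≃-trans (toℚᵘ-homo-* (m / 1) (i / d))
  (≃-trans (*-cong (toℚᵘ-/ m 1) (toℚᵘ-/ i d))
           (*≡* (cong (λ k → m * i * + k) (sym (ℕ.*-identityˡ d)))))

scaled≡integer⇔ : ∀ m i d .{{_ : ℕ.NonZero d}} z → (m / 1) ℚ.* (i / d) ≡ z / 1 ⇔ m * i ≡ z * + d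
scaled≡integer⇔ m i d@(suc _) z = mk⇔
  (λ q≡z → cross-multiplied
     (≃-trans (≃-sym (toℚᵘ-scaled m i d)) (≃-trans (toℚᵘ-cong q≡z) (toℚᵘ-/ z 1))))
  (λ eq → toℚᵘ-injective (≃-trans (toℚᵘ-scaled m i d)
            (≃-trans (*≡* (trans (ℤ.*-identityʳ (m * i)) eq)) (≃-sym (toℚᵘ-/ z 1)))))
  where
  cross-multiplied : (m * i) /ᵘ d ≃ᵘ z /ᵘ 1 → m * i ≡ z * + d
  cross-multiplied (*≡* eq) = trans (sym (ℤ.*-identityʳ (m * i))) eq

isInteger-scaled⇔∣ : ∀ m i d .{{_ : ℕ.NonZero d}} → IsIntegerℚ ((m / 1) ℚ.* (i / d)) ⇔ + d ∣ m * i
isInteger-scaled⇔∣ m i d = mk⇔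
  (λ (z , eq) → divides z (Equivalence.to (scaled≡integer⇔ m i d z) eq))
  (λ (divides z eq) → z , Equivalence.from (scaled≡integer⇔ m i d z) eq)

module _ {p} {P : ℕ → Set p} (P? : Decidable P) (P-mono : ∀ {j k} → j ℕ.≤ k → P j → P k) where

  least-upward-closed : ∀ {m} → P m → ∃[ k ] P k × (∀ j → j ℕ.< k → ¬ P j)
  least-upward-closed {zero}  P0  = zero , P0 , λ _ ()
  least-upward-closed {suc m} Psm with P? m
  ... | yes Pm = least-upward-closed Pm
  ... | no ¬Pm = suc m , Psm , λ j j<sm Pj → ¬Pm (P-mono (ℕ.≤-pred j<sm) Pj)

gran-bound⇒∣ : ∀ n i g → (∀ k → IsGran (_/_ i (2 ^ n) {{ℕ.m^n≢0 2 n}}) k → k ℕ.≤ g) →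
               + (2 ^ n) ∣ + (2 ^ g) * i
gran-bound⇒∣ n i g gran≤g = P-mono (gran≤g k gran≡k) Pk
  where
  instance _ = ℕ.m^n≢0 2 n
  P : ℕ → Set
  P j = + (2 ^ n) ∣ + (2 ^ j) * i
  P-mono : ∀ {j k} → j ℕ.≤ k → P j → P k
  P-mono j≤k Pj = ∣-trans Pj (*-monoˡ-∣ i (^-monoʳ-∣ 2 j≤k))
  least : ∃[ k ] P k × (∀ j → j ℕ.< k → ¬ P j)
  least = least-upward-closed (λ j → + (2 ^ n) ∣? + (2 ^ j) * i) P-mono {n} (∣m⇒∣m*n i ∣-refl)
  k : ℕ
  k = proj₁ least
  Pk : P k
  Pk = proj₁ (proj₂ least)
  gran≡k : IsGran (i / 2 ^ n) k
  gran≡k = Equivalence.from (isInteger-scaled⇔∣ (+ (2 ^ k)) i (2 ^ n)) Pk ,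
           λ j j<k → proj₂ (proj₂ least) j j<k ∘ Equivalence.to (isInteger-scaled⇔∣ (+ (2 ^ j)) i (2 ^ n))

granular⇒4∣subcubeSum : ∀ {n} (f : Point n → ℤ) g T → (∀ S → + (2 ^ n) ∣ + (2 ^ g) * fourierSum f S) →
                        g ℕ.+ 2 ℕ.≤ ∣ T ∣ → + 4 ∣ subcubeSum f T
granular⇒4∣subcubeSum {n} f g T 2ⁿ∣2ᵍf̂ g+2≤∣T∣ =
  *-cancelˡ-∣ (+ (2 ^ g)) {{ℕ.m^n≢0 2 g}}
    (*-cancelˡ-∣ (+ (2 ^ k)) {{ℕ.m^n≢0 2 k}} (∣-trans 2ᵏ⁺ᵍ⁺²∣2ⁿ 2ⁿ∣2ᵏ2ᵍB))
  where
  k = ∣ ∁ T ∣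
  B = subcubeSum f T
  2ᵏ⁺ᵍ⁺²∣2ⁿ : + (2 ^ k) * (+ (2 ^ g) * + 4) ∣ + (2 ^ n)
  2ᵏ⁺ᵍ⁺²∣2ⁿ = subst₂ _∣_ (trans (pos-2^-distrib-+ k (g ℕ.+ 2)) (cong (+ (2 ^ k) *_) (pos-2^-distrib-+ g 2)))
                         (cong (λ m → + (2 ^ m)) (∣∁p∣+∣p∣≡n T))
                         (^-monoʳ-∣ 2 (ℕ.+-monoʳ-≤ k g+2≤∣T∣))
  2ⁿ∣2ᵏ2ᵍB : + (2 ^ n) ∣ + (2 ^ k) * (+ (2 ^ g) * B)
  2ⁿ∣2ᵏ2ᵍB = subst (+ (2 ^ n) ∣_) (begin
    ∑[ S ∈ allVecs n ] (⟦ monomial S (∁ T) ⟧ * (+ (2 ^ g) * fourierSum f S))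
      ≡⟨ ∑-cong (allVecs n) (λ S → *-x∙yz≈y∙xz ⟦ monomial S (∁ T) ⟧ (+ (2 ^ g)) (fourierSum f S)) ⟩
    ∑[ S ∈ allVecs n ] (+ (2 ^ g) * (⟦ monomial S (∁ T) ⟧ * fourierSum f S))
      ≡⟨ *-distribˡ-∑ (+ (2 ^ g)) (allVecs n) (λ S → ⟦ monomial S (∁ T) ⟧ * fourierSum f S) ⟩
    + (2 ^ g) * ∑[ S ∈ allVecs n ] (⟦ monomial S (∁ T) ⟧ * fourierSum f S)
      ≡⟨ cong (+ (2 ^ g) *_) (∑-fourierSum-⊆∁ f T) ⟩
    + (2 ^ g) * (+ (2 ^ k) * B)
      ≡⟨ *-x∙yz≈y∙xz (+ (2 ^ g)) (+ (2 ^ k)) B ⟩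
    + (2 ^ k) * (+ (2 ^ g) * B) ∎)
    (∣-∑ (allVecs n) _ λ S → ∣n⇒∣m*n ⟦ monomial S (∁ T) ⟧ (2ⁿ∣2ᵍf̂ S))
    where open ≡-Reasoning

subcubeSum-+-count : ∀ {n} (f : Point n → ℤ) (p : F2Poly n) T → (∀ x → f x + + 2 * ⟦ evalF2 p x ⟧ ≡ + 1) →
  subcubeSum f T + + 2 * ∑[ x ∈ allVecs n ] ⟦ monomial x T ∧ evalF2 p x ⟧ ≡ + (2 ^ ∣ T ∣)
subcubeSum-+-count {n} f p T f+2p≡1 = begin
  subcubeSum f T + + 2 * ∑[ x ∈ allVecs n ] ⟦ monomial x T ∧ evalF2 p x ⟧
    ≡⟨ cong (_+_ (subcubeSum f T)) (sym (*-distribˡ-∑ (+ 2) (allVecs n) _)) ⟩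
  subcubeSum f T + ∑[ x ∈ allVecs n ] (+ 2 * ⟦ monomial x T ∧ evalF2 p x ⟧)
    ≡⟨ sym (∑-distrib-+ (allVecs n) _ _) ⟩
  ∑[ x ∈ allVecs n ] (f x * ⟦ monomial x T ⟧ + + 2 * ⟦ monomial x T ∧ evalF2 p x ⟧)
    ≡⟨ ∑-cong (allVecs n) pointwise ⟩
  ∑[ x ∈ allVecs n ] ⟦ monomial x T ⟧
    ≡⟨ subcube-size n T ⟩
  + (2 ^ ∣ T ∣) ∎
  where
  open ≡-Reasoning
  factor : ∀ a m e → a * m + + 2 * (m * e) ≡ (a + + 2 * e) * m
  factor = solve-∀
  pointwise : ∀ x → f x * ⟦ monomial x T ⟧ + + 2 * ⟦ monomial x T ∧ evalF2 p x ⟧ ≡ ⟦ monomial x T ⟧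
  pointwise x = begin
    f x * ⟦ monomial x T ⟧ + + 2 * ⟦ monomial x T ∧ evalF2 p x ⟧
      ≡⟨ cong (λ c → f x * ⟦ monomial x T ⟧ + + 2 * c) (⟦∧⟧ (monomial x T) (evalF2 p x)) ⟩
    f x * ⟦ monomial x T ⟧ + + 2 * (⟦ monomial x T ⟧ * ⟦ evalF2 p x ⟧)
      ≡⟨ factor (f x) ⟦ monomial x T ⟧ ⟦ evalF2 p x ⟧ ⟩
    (f x + + 2 * ⟦ evalF2 p x ⟧) * ⟦ monomial x T ⟧
      ≡⟨ cong (_* ⟦ monomial x T ⟧) (f+2p≡1 x) ⟩
    + 1 * ⟦ monomial x T ⟧
      ≡⟨ ℤ.*-identityˡ _ ⟩
    ⟦ monomial x T ⟧ ∎

2∤1 : ¬ + 2 ∣ + 1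
2∤1 2∣1 with ℕ.∣⇒≤ (∣⇒∣ᵤ 2∣1)
... | ℕ.s≤s ()

monomial⇒¬4∣subcubeSum : ∀ {n} (f : Point n → ℤ) (p : F2Poly n) T → (∀ x → f x + + 2 * ⟦ evalF2 p x ⟧ ≡ + 1) →
                         p T ≡ true → 2 ℕ.≤ ∣ T ∣ → ¬ + 4 ∣ subcubeSum f T
monomial⇒¬4∣subcubeSum {n} f p T f+2p≡1 pT≡1 2≤∣T∣ 4∣B = 2∤1 (∣m+n∣n⇒∣m 2∣1+2q (divides q refl))
  where
  C = ∑[ x ∈ allVecs n ] ⟦ monomial x T ∧ evalF2 p x ⟧
  q = proj₁ (∑-⟦⟧-parity (allVecs n) λ x → monomial x T ∧ evalF2 p x)
  C≡1+2q : C ≡ + 1 + q * + 2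
  C≡1+2q = trans (proj₂ (∑-⟦⟧-parity (allVecs n) λ x → monomial x T ∧ evalF2 p x))
                 (cong (λ b → ⟦ b ⟧ + q * + 2) (trans (evalF2-möbius n p T) pT≡1))
  4∣2C : + 4 ∣ + 2 * C
  4∣2C = ∣m+n∣m⇒∣n (subst (+ 4 ∣_) (sym (subcubeSum-+-count f p T f+2p≡1)) (^-monoʳ-∣ 2 2≤∣T∣)) 4∣B
  2∣1+2q : + 2 ∣ + 1 + q * + 2
  2∣1+2q = subst (+ 2 ∣_) C≡1+2q (*-cancelˡ-∣ (+ 2) 4∣2C)

f+2p≡1 : ∀ {n} {f : Point n → ℤ} {p : F2Poly n} → IsBoolFun f → Represents f p →
         ∀ x → f x + + 2 * ⟦ evalF2 p x ⟧ ≡ + 1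
f+2p≡1 {p = p} isBool rep x with evalF2 p x in px | isBool x
... | true  | _          = cong (_+ + 2) (proj₁ (rep x) px)
... | false | inj₁ fx≡1  = cong (_+ + 0) fx≡1
... | false | inj₂ fx≡-1 with trans (sym px) (proj₂ (rep x) fx≡-1)
...   | ()

lemma1 : (n : ℕ) → 1 ℕ.≤ n → (f : Point n → ℤ) → IsBoolFun f →
    (g : ℕ) → IsGranF f g → (p : F2Poly n) → Represents f p →
    DegreeAtMost p (g ℕ.+ 1)
lemma1 n _ f isBool g (_ , gran≤g) p rep T pT≡1 = ℕ.≮⇒≥ λ g+1<∣T∣ →
  let g+2≤∣T∣ = subst (ℕ._≤ ∣ T ∣) (sym (ℕ.+-suc g 1)) g+1<∣T∣ in
  monomial⇒¬4∣subcubeSum f p T (f+2p≡1 isBool rep) pT≡1 (ℕ.≤-trans (ℕ.m≤n+m 2 g) g+2≤∣T∣)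
    (granular⇒4∣subcubeSum f g T (λ S → gran-bound⇒∣ n (fourierSum f S) g (gran≤g S)) g+2≤∣T∣)
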